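{- Let $r<s\le N/2$ be positive integers and $i\in\{1,\dots,N\}$. Consider a square $S$ whose vertices carry the labels $i,\ i+s,\ i+r+s,\ i+r$ (each reduced mod $N$ to lie in $\{1,\dots,N\}$), in clockwise order starting from the lower-left corner, so that its horizontal edges join the labels $i,i+r$ and $i+s,i+r+s$ and its vertical edges join $i,i+s$ and $i+r,i+r+s$. Orient each horizontal edge from the smaller label to the larger one and each vertical edge from the larger label to the smaller one. Then either the four edges of $S$ form an oriented 4-cycle, or $S$ can be split into two cyclically oriented triangles by adding a single oriented diagonal. -}

module Defs where

open import Data.Nat using (ℕ; zero; suc; _+_; _∸_; _<_; _%_)
open import Data.Product using (_×_; ∃-syntax)
open import Data.Empty using (⊥)
open import Data.Sum using (_⊎_)
open import Relation.Binary.PropositionalEquality using (_≢_)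

-- Reduce a positive integer x modulo N to the representative in {1,…,N}.
-- (For N = 0 it is left unchanged; the theorem always has N ≥ 2.)
reduce : ℕ → ℕ → ℕ
reduce zero    x = x
reduce (suc n) x = suc ((x ∸ 1) % suc n)

data Corner : Set where
  LL UL UR LR : Corner

label : (N r s i : ℕ) → Corner → ℕ
label N r s i LL = reduce N i
label N r s i UL = reduce N (i + s)
label N r s i UR = reduce N (i + r + s)
label N r s i LR = reduce N (i + r)

-- Arrow ℓ u v : the square's edge between u and v is oriented from u to v.
Arrow : (Corner → ℕ) → Corner → Corner → Set
Arrow ℓ LL LR = ℓ LL < ℓ LR
Arrow ℓ LR LL = ℓ LR < ℓ LL
Arrow ℓ UL UR = ℓ UL < ℓ UR
Arrow ℓ UR UL = ℓ UR < ℓ UL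
Arrow ℓ LL UL = ℓ UL < ℓ LL
Arrow ℓ UL LL = ℓ LL < ℓ UL
Arrow ℓ LR UR = ℓ UR < ℓ LR
Arrow ℓ UR LR = ℓ LR < ℓ UR
Arrow ℓ _  _  = ⊥

Oriented4Cycle : (Corner → ℕ) → Set
Oriented4Cycle ℓ =
  (Arrow ℓ LL UL × Arrow ℓ UL UR × Arrow ℓ UR LR × Arrow ℓ LR LL)
  ⊎ (Arrow ℓ LL LR × Arrow ℓ LR UR × Arrow ℓ UR UL × Arrow ℓ UL LL)

data Diagonal : Corner → Corner → Set where
  LL→UR : Diagonal LL UR
  UR→LL : Diagonal UR LL
  UL→LR : Diagonal UL LR
  LR→UL : Diagonal LR UL

SplitsIntoCyclicTriangles : (Corner → ℕ) → Set
SplitsIntoCyclicTriangles ℓ =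
  ∃[ u ] ∃[ v ] (Diagonal u v ×
    (∀ w → w ≢ u → w ≢ v → Arrow ℓ v w × Arrow ℓ w u))

-- Write a = i - 1.  The numbers a < a + r < a + s < a + r + s all lie in an
-- interval [a, a + N) of length N, because r + s < 2s ≤ N.  Reduction modulo N
-- maps such an interval onto a cyclic shift of {0, …, N - 1}, so it preserves
-- the cyclic order of the four labels: one of the four rotations of the
-- labels at LL, LR, UL, UR is increasing.  Two of the rotations orient the
-- boundary of the square as a 4-cycle; in the other two the diagonal LR → UL
-- resp. UR → LL cuts it into two cyclic triangles.
module Submission where

open import Defs
open import Data.Nat using (ℕ; zero; suc; _+_; _∸_; _*_; _%_; _≤_; _<_; _<?_; NonZero; s≤s)
open import Data.Nat.Properties
open import Data.Nat.DivMod using (m<n⇒m%n≡m; m≤n⇒[n∸m]%m≡n%m)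
open import Data.Product using (_×_; _,_)
open import Data.Sum using (_⊎_; inj₁; inj₂)
open import Data.Empty using (⊥-elim)
open import Relation.Binary.PropositionalEquality using (_≡_; _≢_; refl; sym; trans; subst; subst₂)
open import Relation.Nullary using (Dec; yes; no)

Increasing : ℕ → ℕ → ℕ → ℕ → Set
Increasing a b c d = a < b × b < c × c < d

CyclicallyOrdered : ℕ → ℕ → ℕ → ℕ → Set
CyclicallyOrdered a b c d =
  Increasing a b c d ⊎ Increasing b c d a ⊎ Increasing c d a b ⊎ Increasing d a b c

cyclicallyOrdered-map : ∀ (f : ℕ → ℕ) → (∀ {m n} → m < n → f m < f n) →
  ∀ {a b c d} → CyclicallyOrdered a b c d → CyclicallyOrdered (f a) (f b) (f c) (f d)
cyclicallyOrdered-map f f-mono = map-rotation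
  where
  map-increasing : ∀ {a b c d} → Increasing a b c d → Increasing (f a) (f b) (f c) (f d)
  map-increasing (a<b , b<c , c<d) = f-mono a<b , f-mono b<c , f-mono c<d

  map-rotation : ∀ {a b c d} → CyclicallyOrdered a b c d →
    CyclicallyOrdered (f a) (f b) (f c) (f d)
  map-rotation (inj₁ inc)               = inj₁ (map-increasing inc)
  map-rotation (inj₂ (inj₁ inc))        = inj₂ (inj₁ (map-increasing inc))
  map-rotation (inj₂ (inj₂ (inj₁ inc))) = inj₂ (inj₂ (inj₁ (map-increasing inc)))
  map-rotation (inj₂ (inj₂ (inj₂ inc))) = inj₂ (inj₂ (inj₂ (map-increasing inc)))

diagonal-LR→UL-splits : (ℓ : Corner → ℕ) → Increasing (ℓ LL) (ℓ LR) (ℓ UL) (ℓ UR) →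
  SplitsIntoCyclicTriangles ℓ
diagonal-LR→UL-splits ℓ (a<b , b<c , c<d) = LR , UL , LR→UL , triangle
  where
  triangle : ∀ w → w ≢ LR → w ≢ UL → Arrow ℓ UL w × Arrow ℓ w LR
  triangle LL _    _    = <-trans a<b b<c , a<b
  triangle UR _    _    = c<d , <-trans b<c c<d
  triangle LR w≢LR _    = ⊥-elim (w≢LR refl)
  triangle UL _    w≢UL = ⊥-elim (w≢UL refl)

diagonal-UR→LL-splits : (ℓ : Corner → ℕ) → Increasing (ℓ UL) (ℓ UR) (ℓ LL) (ℓ LR) →
  SplitsIntoCyclicTriangles ℓ
diagonal-UR→LL-splits ℓ (c<d , d<a , a<b) = UR , LL , UR→LL , triangle
  where
  triangle : ∀ w → w ≢ UR → w ≢ LL → Arrow ℓ LL w × Arrow ℓ w UR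
  triangle UL _    _    = <-trans c<d d<a , c<d
  triangle LR _    _    = a<b , <-trans d<a a<b
  triangle UR w≢UR _    = ⊥-elim (w≢UR refl)
  triangle LL _    w≢LL = ⊥-elim (w≢LL refl)

cyclicallyOrdered⇒4cycle-or-splits : (ℓ : Corner → ℕ) →
  CyclicallyOrdered (ℓ LL) (ℓ LR) (ℓ UL) (ℓ UR) →
  Oriented4Cycle ℓ ⊎ SplitsIntoCyclicTriangles ℓ
cyclicallyOrdered⇒4cycle-or-splits ℓ (inj₁ inc) = inj₂ (diagonal-LR→UL-splits ℓ inc)
cyclicallyOrdered⇒4cycle-or-splits ℓ (inj₂ (inj₁ (b<c , c<d , d<a))) =
  inj₁ (inj₁ (<-trans c<d d<a , c<d , <-trans b<c c<d , <-trans (<-trans b<c c<d) d<a))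
cyclicallyOrdered⇒4cycle-or-splits ℓ (inj₂ (inj₂ (inj₁ inc))) = inj₂ (diagonal-UR→LL-splits ℓ inc)
cyclicallyOrdered⇒4cycle-or-splits ℓ (inj₂ (inj₂ (inj₂ (d<a , a<b , b<c)))) =
  inj₁ (inj₂ (a<b , <-trans d<a a<b , <-trans (<-trans d<a a<b) b<c , <-trans a<b b<c))

module _ (N : ℕ) .{{_ : NonZero N}} where

  m≥n⇒m%n≡m∸n : ∀ {y} → N ≤ y → y < N + N → y % N ≡ y ∸ N
  m≥n⇒m%n≡m∸n {y} N≤y y<2N = trans (sym (m≤n⇒[n∸m]%m≡n%m N≤y)) (m<n⇒m%n≡m y∸N<N)
    where
    y∸N<N : y ∸ N < N
    y∸N<N = subst (y ∸ N <_) (m+n∸n≡m N N) (∸-monoˡ-< y<2N N≤y)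

  %-mono-<-below : ∀ {y z} → y < z → z < N → y % N < z % N
  %-mono-<-below {y} {z} y<z z<N =
    subst₂ _<_ (sym (m<n⇒m%n≡m (<-trans y<z z<N))) (sym (m<n⇒m%n≡m z<N)) y<z

  %-mono-<-above : ∀ {y z} → N ≤ y → y < z → z < N + N → y % N < z % N
  %-mono-<-above {y} {z} N≤y y<z z<2N =
    subst₂ _<_ (sym (m≥n⇒m%n≡m∸n N≤y (<-trans y<z z<2N)))
               (sym (m≥n⇒m%n≡m∸n (≤-trans N≤y (<⇒≤ y<z)) z<2N))
               (∸-monoˡ-< y<z N≤y)

  %-wraps-below : ∀ {a y} → a < N → N ≤ y → y < a + N → y % N < a % N
  %-wraps-below {a} {y} a<N N≤y y<a+N =
    subst₂ _<_ (sym (m≥n⇒m%n≡m∸n N≤y (<-≤-trans y<a+N (+-monoˡ-≤ N (<⇒≤ a<N)))))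
               (trans (m+n∸n≡m a N) (sym (m<n⇒m%n≡m a<N)))
               (∸-monoˡ-< y<a+N N≤y)

  %-preserves-cyclicOrder : ∀ {a b c d} → a < N → a < b → b < c → c < d → d < a + N →
    CyclicallyOrdered (a % N) (b % N) (c % N) (d % N)
  %-preserves-cyclicOrder {a} {b} {c} {d} a<N a<b b<c c<d d<a+N =
    rotation (b <? N) (c <? N) (d <? N)
    where
    d<2N : d < N + N
    d<2N = <-≤-trans d<a+N (+-monoˡ-≤ N (<⇒≤ a<N))

    c<2N : c < N + N
    c<2N = <-trans c<d d<2N

    d%N<a%N : N ≤ d → d % N < a % N
    d%N<a%N N≤d = %-wraps-below a<N N≤d d<a+N

    rotation : Dec (b < N) → Dec (c < N) → Dec (d < N) →
      CyclicallyOrdered (a % N) (b % N) (c % N) (d % N)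
    rotation _         _         (yes d<N) = inj₁
      ( %-mono-<-below a<b (<-trans b<c (<-trans c<d d<N))
      , %-mono-<-below b<c (<-trans c<d d<N)
      , %-mono-<-below c<d d<N )
    rotation _         (yes c<N) (no d≮N)  = inj₂ (inj₂ (inj₂
      ( d%N<a%N (≮⇒≥ d≮N)
      , %-mono-<-below a<b (<-trans b<c c<N)
      , %-mono-<-below b<c c<N )))
    rotation (yes b<N) (no c≮N)  (no d≮N)  = inj₂ (inj₂ (inj₁
      ( %-mono-<-above (≮⇒≥ c≮N) c<d d<2N
      , d%N<a%N (≮⇒≥ d≮N)
      , %-mono-<-below a<b b<N )))
    rotation (no b≮N)  (no c≮N)  (no d≮N)  = inj₂ (inj₁
      ( %-mono-<-above (≮⇒≥ b≮N) b<c c<2N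
      , %-mono-<-above (≮⇒≥ c≮N) c<d d<2N
      , d%N<a%N (≮⇒≥ d≮N) ))

proposition3p6 : (N r s i : ℕ) → 1 ≤ r → r < s → 2 * s ≤ N → 1 ≤ i → i ≤ N →
    Oriented4Cycle (label N r s i) ⊎ SplitsIntoCyclicTriangles (label N r s i)
proposition3p6 zero    r zero    i       _   ()  _    _ _
proposition3p6 zero    r (suc s) i       _   _   ()   _ _
proposition3p6 (suc _) r s       zero    _   _   _    () _
proposition3p6 N@(suc _) r s     (suc a) 1≤r r<s 2s≤N _ a<N =
  cyclicallyOrdered⇒4cycle-or-splits (label N r s (suc a))
    -- label N r s (suc a) LL reduces to suc (a % N), and likewise at the other corners
    (cyclicallyOrdered-map suc s≤s
      (%-preserves-cyclicOrder N a<N a<a+r (+-monoʳ-< a r<s) (+-monoˡ-< s a<a+r) a+r+s<a+N))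
  where
  a<a+r : a < a + r
  a<a+r = m<m+n a 1≤r

  a+r+s<a+N : a + r + s < a + N
  a+r+s<a+N = subst (_< a + N) (sym (+-assoc a r s))
    (+-monoʳ-< a (<-≤-trans (+-mono-<-≤ r<s (m≤m+n s 0)) 2s≤N))
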